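{- Let $\mathsf{IntQCL}=\mathsf{G3IntQC}+\{(id^*_q),(\neg_l),(\neg_r),(\supset^*_l),(\forall^*_r),(\forall^*_l),(\exists^*_r),(lift)\}$ and let $\mathsf{IntQCL}^-$ be $\mathsf{IntQCL}$ without the rules $(id_q),(\bot_l),(\supset_l),(\forall_l),(\forall_r),(\exists_r),(ref),(tra),(nd),(cd)$. Then every labelled sequent derivable in $\mathsf{IntQCL}$ is derivable in $\mathsf{IntQCL}^-$; i.e. these ten rules are admissible in $\mathsf{IntQCL}^-$.
   Context: First-order formulas: $A::= p(x_1,\dots,x_n)\mid \neg A\mid (A\vee A)\mid(A\wedge A)\mid(A\supset A)\mid \forall x A\mid\exists xA$ (0-ary predicates are propositional variables); for a fixed propositional variable $p_0$, $\bot$ abbreviates $p_0\wedge\neg p_0$. Bound variables are distinct from parameters $a,b,\dots$, which replace free variables. $A[a/x]$: substitution of $a$ for free $x$; $p(\vec{a})$ with $\vec{a}=a_0,\dots,a_n$ all its parameters; $\vec{a}\in D_w$ abbreviates $a_0\in D_w,\dots,a_n\in D_w$. Labelled sequents $\mathcal{R},\Gamma\Rightarrow\Delta$: $\mathcal{R}$ a multiset of relational atoms $w\le v$ and domain atoms $a\in D_w$, $\Gamma,\Delta$ multisets of labelled formulas $w:A$. $\mathsf{G3IntQC}$ rules: $(id_q)$: $\mathcal{R},w\le v,\vec{a}\in D_w,w:p(\vec{a}),\Gamma\Rightarrow\Delta,v:p(\vec{a})$ (its 0-ary case is $(id)$); $(\bot_l)$: $\mathcal{R},w:\bot,\Gamma\Rightarrow\Delta$;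 $(\wedge_l)$: from $\mathcal{R},w:A,w:B,\Gamma\Rightarrow\Delta$ infer $\mathcal{R},w:A\wedge B,\Gamma\Rightarrow\Delta$; $(\wedge_r)$: from $\mathcal{R},\Gamma\Rightarrow\Delta,w:A$ and $\mathcal{R},\Gamma\Rightarrow\Delta,w:B$ infer $\mathcal{R},\Gamma\Rightarrow\Delta,w:A\wedge B$; $(\vee_l)$: from $\mathcal{R},w:A,\Gamma\Rightarrow\Delta$ and $\mathcal{R},w:B,\Gamma\Rightarrow\Delta$ infer $\mathcal{R},w:A\vee B,\Gamma\Rightarrow\Delta$; $(\vee_r)$: from $\mathcal{R},\Gamma\Rightarrow\Delta,w:A,w:B$ infer $\mathcal{R},\Gamma\Rightarrow\Delta,w:A\vee B$; $(\supset_r)$: from $\mathcal{R},w\le v,v:A,\Gamma\Rightarrow\Delta,v:B$ infer $\mathcal{R},\Gamma\Rightarrow\Delta,w:A\supset B$, $v$ not in the conclusion; $(\supset_l)$: from $\mathcal{R},w\le v,w:A\supset B,\Gamma\Rightarrow\Delta,v:A$ and $\mathcal{R},w\le v,w:A\supset B,v:B,\Gamma\Rightarrow\Delta$ infer $\mathcal{R},w\le v,w:A\supset B,\Gamma\Rightarrow\Delta$; $(ref)$: from $\mathcal{R},w\le w,\Gamma\Rightarrow\Delta$ infer $\mathcal{R},\Gamma\Rightarrow\Delta$; $(tra)$: from $\mathcal{R},w\le v,v\le u,w\le u,\Gamma\Rightarrow\Delta$ infer $\mathcal{R},w\le v,v\le u,\Gamma\Rightarrow\Delta$; $(\forall_r)$: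 from $\mathcal{R},w\le v,a\in D_v,\Gamma\Rightarrow\Delta,v:A[a/x]$ infer $\mathcal{R},\Gamma\Rightarrow\Delta,w:\forall xA$, $a,v$ not in the conclusion; $(\exists_r)$: from $\mathcal{R},a\in D_w,\Gamma\Rightarrow\Delta,w:A[a/x],w:\exists xA$ infer $\mathcal{R},a\in D_w,\Gamma\Rightarrow\Delta,w:\exists xA$; $(\exists_l)$: from $\mathcal{R},a\in D_w,w:A[a/x],\Gamma\Rightarrow\Delta$ infer $\mathcal{R},w:\exists xA,\Gamma\Rightarrow\Delta$, $a$ not in the conclusion; $(\forall_l)$: from $\mathcal{R},w\le v,a\in D_v,v:A[a/x],w:\forall xA,\Gamma\Rightarrow\Delta$ infer $\mathcal{R},w\le v,a\in D_v,w:\forall xA,\Gamma\Rightarrow\Delta$; $(nd)$: from $\mathcal{R},w\le v,a\in D_w,a\in D_v,\Gamma\Rightarrow\Delta$ infer $\mathcal{R},w\le v,a\in D_w,\Gamma\Rightarrow\Delta$; $(cd)$: from $\mathcal{R},w\le v,a\in D_v,a\in D_w,\Gamma\Rightarrow\Delta$ infer $\mathcal{R},w\le v,a\in D_v,\Gamma\Rightarrow\Delta$. Additional rules: a (not necessarily directed) path from $v$ to $w$ in $\mathcal{R}$ exists iff $v=w$ or there are labels $v=z_0,\dots,z_k=w$ with $z_i\le z_{i+1}$ or $z_{i+1}\le z_i$ in $\mathcal{R}$ for each $i$. $(id^*_q)$: $\mathcal{R},a_0\in D_{v_0},\dots,a_n\in D_{v_n},w:p(\vec{a}),\Gamma\Rightarrow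 w:p(\vec{a}),\Delta$, $\vec{a}=a_0,\dots,a_n$, with a path from each $v_i$ to $w$ in $\mathcal{R}$; $(\neg_r)$: from $\mathcal{R},w\le v,v:A,\Gamma\Rightarrow\Delta$ infer $\mathcal{R},\Gamma\Rightarrow\Delta,w:\neg A$, $v$ not in the conclusion; $(\neg_l)$: from $\mathcal{R},w:\neg A,\Gamma\Rightarrow\Delta,w:A$ infer $\mathcal{R},w:\neg A,\Gamma\Rightarrow\Delta$; $(\supset^*_l)$: from $\mathcal{R},w:A\supset B,\Gamma\Rightarrow\Delta,w:A$ and $\mathcal{R},w:A\supset B,w:B,\Gamma\Rightarrow\Delta$ infer $\mathcal{R},w:A\supset B,\Gamma\Rightarrow\Delta$; $(\forall^*_r)$: from $\mathcal{R},a\in D_w,\Gamma\Rightarrow w:A[a/x],\Delta$ infer $\mathcal{R},\Gamma\Rightarrow w:\forall xA,\Delta$, $a$ not in the conclusion; $(\forall^*_l)$: from $\mathcal{R},a\in D_v,w:A[a/x],w:\forall xA,\Gamma\Rightarrow\Delta$ infer $\mathcal{R},a\in D_v,w:\forall xA,\Gamma\Rightarrow\Delta$, provided a path from $v$ to $w$ in $\mathcal{R}$; $(\exists^*_r)$: from $\mathcal{R},a\in D_v,\Gamma\Rightarrow\Delta,w:A[a/x],w:\exists xA$ infer $\mathcal{R},a\in D_v,\Gamma\Rightarrow\Delta,w:\exists xA$, provided a path from $v$ to $w$ in $\mathcal{R}$; $(lift)$: from $\mathcal{R},w\le u,w:A,u:A,\Gamma\Rightarrow\Delta$ infer $\mathcal{R},w\le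 u,w:A,\Gamma\Rightarrow\Delta$. -}

module Defs where

open import Data.Nat using (ℕ; _≟_)
open import Data.List using (List; []; _∷_; _++_; concatMap)
open import Data.List.Membership.Propositional using (_∈_; _∉_)
open import Data.List.Relation.Binary.Permutation.Propositional using (_↭_)
open import Data.Product using (_×_; _,_; ∃-syntax)
open import Data.Sum using (_⊎_)
open import Relation.Nullary using (does)
open import Data.Bool using (if_then_else_)
open import Relation.Binary.PropositionalEquality using (_≡_)

Var Param Pred Label : Set
Var   = ℕ
Param = ℕ
Pred  = ℕ
Label = ℕ

data Term : Set where
  var : Var → Term
  par : Param → Term

data Formula : Set where
  atom  : Pred → List Term → Formula     -- p(t₁,…,tₙ); n = 0 gives propositional variables
  ¬'_   : Formula → Formula
  _∨'_  : Formula → Formula → Formula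
  _∧'_  : Formula → Formula → Formula
  _⊃'_  : Formula → Formula → Formula
  ∀'    : Var → Formula → Formula
  ∃'    : Var → Formula → Formula

p₀ : Formula
p₀ = atom 0 []

⊥' : Formula
⊥' = p₀ ∧' (¬' p₀)

substT : Param → Var → Term → Term
substT a x (var y) = if does (y ≟ x) then par a else var y
substT a x (par b) = par b

substTs : Param → Var → List Term → List Term
substTs a x []       = []
substTs a x (t ∷ ts) = substT a x t ∷ substTs a x ts

_[_/_] : Formula → Param → Var → Formula
atom p ts  [ a / x ] = atom p (substTs a x ts)
(¬' A)     [ a / x ] = ¬' (A [ a / x ])
(A ∨' B)   [ a / x ] = (A [ a / x ]) ∨' (B [ a / x ])
(A ∧' B)   [ a / x ] = (A [ a / x ]) ∧' (B [ a / x ])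
(A ⊃' B)   [ a / x ] = (A [ a / x ]) ⊃' (B [ a / x ])
∀' y A     [ a / x ] = if does (y ≟ x) then ∀' y A else ∀' y (A [ a / x ])
∃' y A     [ a / x ] = if does (y ≟ x) then ∃' y A else ∃' y (A [ a / x ])

paramsTs : List Term → List Param
paramsTs []            = []
paramsTs (var _ ∷ ts)  = paramsTs ts
paramsTs (par a ∷ ts)  = a ∷ paramsTs ts

paramsF : Formula → List Param
paramsF (atom p ts) = paramsTs ts
paramsF (¬' A)      = paramsF A
paramsF (A ∨' B)    = paramsF A ++ paramsF B
paramsF (A ∧' B)    = paramsF A ++ paramsF B
paramsF (A ⊃' B)    = paramsF A ++ paramsF B
paramsF (∀' _ A)    = paramsF A
paramsF (∃' _ A)    = paramsF A

data RAtom : Set where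
  _≤ᵣ_  : Label → Label → RAtom
  _∈D_  : Param → Label → RAtom

LFormula : Set
LFormula = Label × Formula

-- multisets are represented by lists, taken up to permutation
-- (rule `perm` below)
infix 2 _∣_⇒_
record Sequent : Set where
  constructor _∣_⇒_
  field
    rel  : List RAtom
    ante : List LFormula
    succ : List LFormula

labelsR : RAtom → List Label
labelsR (w ≤ᵣ v) = w ∷ v ∷ []
labelsR (a ∈D w) = w ∷ []

paramsR : RAtom → List Param
paramsR (w ≤ᵣ v) = []
paramsR (a ∈D w) = a ∷ []

labelsL : LFormula → List Label
labelsL (w , _) = w ∷ []

paramsL : LFormula → List Param
paramsL (_ , A) = paramsF A

labels : Sequent → List Label
labels (R ∣ Γ ⇒ Δ) = concatMap labelsR R ++ concatMap labelsL Γ ++ concatMap labelsL Δ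

params : Sequent → List Param
params (R ∣ Γ ⇒ Δ) = concatMap paramsR R ++ concatMap paramsL Γ ++ concatMap paramsL Δ

-- (not necessarily directed) path from v to w in R
data Path (R : List RAtom) : Label → Label → Set where
  here : ∀ {w} → Path R w w
  fwd  : ∀ {v u w} → (v ≤ᵣ u) ∈ R → Path R u w → Path R v w
  bwd  : ∀ {v u w} → (u ≤ᵣ v) ∈ R → Path R u w → Path R v w

-- The calculi IntQCL (full) and IntQCL⁻ (minus).  Rules of G3IntQC
-- removed in IntQCL⁻ only conclude `Deriv full _`.

data System : Set where
  full minus : System

infix 3 Deriv
data Deriv : System → Sequent → Set where
  perm  : ∀ {s R R' Γ Γ' Δ Δ'} → R ↭ R' → Γ ↭ Γ' → Δ ↭ Δ' →
          Deriv s (R ∣ Γ ⇒ Δ) → Deriv s (R' ∣ Γ' ⇒ Δ')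

  id-q  : ∀ {R Γ Δ w v p ts} → (w ≤ᵣ v) ∈ R →
          (∀ {a} → a ∈ paramsTs ts → (a ∈D w) ∈ R) →
          (w , atom p ts) ∈ Γ → (v , atom p ts) ∈ Δ →
          Deriv full (R ∣ Γ ⇒ Δ)
  ⊥-l   : ∀ {R Γ Δ w} → (w , ⊥') ∈ Γ → Deriv full (R ∣ Γ ⇒ Δ)
  ∧-l   : ∀ {s R Γ Δ w A B} → Deriv s (R ∣ (w , A) ∷ (w , B) ∷ Γ ⇒ Δ) →
          Deriv s (R ∣ (w , A ∧' B) ∷ Γ ⇒ Δ)
  ∧-r   : ∀ {s R Γ Δ w A B} → Deriv s (R ∣ Γ ⇒ (w , A) ∷ Δ) →
          Deriv s (R ∣ Γ ⇒ (w , B) ∷ Δ) → Deriv s (R ∣ Γ ⇒ (w , A ∧' B) ∷ Δ)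
  ∨-l   : ∀ {s R Γ Δ w A B} → Deriv s (R ∣ (w , A) ∷ Γ ⇒ Δ) →
          Deriv s (R ∣ (w , B) ∷ Γ ⇒ Δ) → Deriv s (R ∣ (w , A ∨' B) ∷ Γ ⇒ Δ)
  ∨-r   : ∀ {s R Γ Δ w A B} → Deriv s (R ∣ Γ ⇒ (w , A) ∷ (w , B) ∷ Δ) →
          Deriv s (R ∣ Γ ⇒ (w , A ∨' B) ∷ Δ)
  ⊃-r   : ∀ {s R Γ Δ w v A B} →
          v ∉ labels (R ∣ Γ ⇒ (w , A ⊃' B) ∷ Δ) →
          Deriv s ((w ≤ᵣ v) ∷ R ∣ (v , A) ∷ Γ ⇒ (v , B) ∷ Δ) →
          Deriv s (R ∣ Γ ⇒ (w , A ⊃' B) ∷ Δ)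
  ⊃-l   : ∀ {R Γ Δ w v A B} → (w ≤ᵣ v) ∈ R → (w , A ⊃' B) ∈ Γ →
          Deriv full (R ∣ Γ ⇒ (v , A) ∷ Δ) →
          Deriv full (R ∣ (v , B) ∷ Γ ⇒ Δ) → Deriv full (R ∣ Γ ⇒ Δ)
  ref   : ∀ {R Γ Δ w} → Deriv full ((w ≤ᵣ w) ∷ R ∣ Γ ⇒ Δ) → Deriv full (R ∣ Γ ⇒ Δ)
  tra   : ∀ {R Γ Δ w v u} → (w ≤ᵣ v) ∈ R → (v ≤ᵣ u) ∈ R →
          Deriv full ((w ≤ᵣ u) ∷ R ∣ Γ ⇒ Δ) → Deriv full (R ∣ Γ ⇒ Δ)
  ∀-r   : ∀ {R Γ Δ w v a x A} →
          v ∉ labels (R ∣ Γ ⇒ (w , ∀' x A) ∷ Δ) →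
          a ∉ params (R ∣ Γ ⇒ (w , ∀' x A) ∷ Δ) →
          Deriv full ((w ≤ᵣ v) ∷ (a ∈D v) ∷ R ∣ Γ ⇒ (v , A [ a / x ]) ∷ Δ) →
          Deriv full (R ∣ Γ ⇒ (w , ∀' x A) ∷ Δ)
  ∃-r   : ∀ {R Γ Δ w a x A} → (a ∈D w) ∈ R → (w , ∃' x A) ∈ Δ →
          Deriv full (R ∣ Γ ⇒ (w , A [ a / x ]) ∷ Δ) → Deriv full (R ∣ Γ ⇒ Δ)
  ∃-l   : ∀ {s R Γ Δ w a x A} →
          a ∉ params (R ∣ (w , ∃' x A) ∷ Γ ⇒ Δ) →
          Deriv s ((a ∈D w) ∷ R ∣ (w , A [ a / x ]) ∷ Γ ⇒ Δ) →
          Deriv s (R ∣ (w , ∃' x A) ∷ Γ ⇒ Δ)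
  ∀-l   : ∀ {R Γ Δ w v a x A} → (w ≤ᵣ v) ∈ R → (a ∈D v) ∈ R → (w , ∀' x A) ∈ Γ →
          Deriv full (R ∣ (v , A [ a / x ]) ∷ Γ ⇒ Δ) → Deriv full (R ∣ Γ ⇒ Δ)
  nd    : ∀ {R Γ Δ w v a} → (w ≤ᵣ v) ∈ R → (a ∈D w) ∈ R →
          Deriv full ((a ∈D v) ∷ R ∣ Γ ⇒ Δ) → Deriv full (R ∣ Γ ⇒ Δ)
  cd    : ∀ {R Γ Δ w v a} → (w ≤ᵣ v) ∈ R → (a ∈D v) ∈ R →
          Deriv full ((a ∈D w) ∷ R ∣ Γ ⇒ Δ) → Deriv full (R ∣ Γ ⇒ Δ)

  id*-q : ∀ {s R Γ Δ w p ts} →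
          (∀ {a} → a ∈ paramsTs ts → ∃[ v ] ((a ∈D v) ∈ R × Path R v w)) →
          (w , atom p ts) ∈ Γ → (w , atom p ts) ∈ Δ →
          Deriv s (R ∣ Γ ⇒ Δ)
  ¬-r   : ∀ {s R Γ Δ w v A} →
          v ∉ labels (R ∣ Γ ⇒ (w , ¬' A) ∷ Δ) →
          Deriv s ((w ≤ᵣ v) ∷ R ∣ (v , A) ∷ Γ ⇒ Δ) →
          Deriv s (R ∣ Γ ⇒ (w , ¬' A) ∷ Δ)
  ¬-l   : ∀ {s R Γ Δ w A} → (w , ¬' A) ∈ Γ →
          Deriv s (R ∣ Γ ⇒ (w , A) ∷ Δ) → Deriv s (R ∣ Γ ⇒ Δ)
  ⊃*-l  : ∀ {s R Γ Δ w A B} → (w , A ⊃' B) ∈ Γ →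
          Deriv s (R ∣ Γ ⇒ (w , A) ∷ Δ) →
          Deriv s (R ∣ (w , B) ∷ Γ ⇒ Δ) → Deriv s (R ∣ Γ ⇒ Δ)
  ∀*-r  : ∀ {s R Γ Δ w a x A} →
          a ∉ params (R ∣ Γ ⇒ (w , ∀' x A) ∷ Δ) →
          Deriv s ((a ∈D w) ∷ R ∣ Γ ⇒ (w , A [ a / x ]) ∷ Δ) →
          Deriv s (R ∣ Γ ⇒ (w , ∀' x A) ∷ Δ)
  ∀*-l  : ∀ {s R Γ Δ w v a x A} → (a ∈D v) ∈ R → Path R v w → (w , ∀' x A) ∈ Γ →
          Deriv s (R ∣ (w , A [ a / x ]) ∷ Γ ⇒ Δ) → Deriv s (R ∣ Γ ⇒ Δ)
  ∃*-r  : ∀ {s R Γ Δ w v a x A} → (a ∈D v) ∈ R → Path R v w → (w , ∃' x A) ∈ Δ →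
          Deriv s (R ∣ Γ ⇒ (w , A [ a / x ]) ∷ Δ) → Deriv s (R ∣ Γ ⇒ Δ)
  lift  : ∀ {s R Γ Δ w u A} → (w ≤ᵣ u) ∈ R → (w , A) ∈ Γ →
          Deriv s (R ∣ (u , A) ∷ Γ ⇒ Δ) → Deriv s (R ∣ Γ ⇒ Δ)

IntQCL IntQCL⁻ : Sequent → Set
IntQCL  S = Deriv full S
IntQCL⁻ S = Deriv minus S

module Submission where

-- A derivation of S in IntQCL is replayed, rule by rule, as an IntQCL⁻
-- derivation of every sequent T that covers S along a renaming σ of labels
-- and τ of parameters: the relational atoms of S hold in the reflexive,
-- transitive closure of those of T (domain atoms up to a path), each left
-- formula of S is implied by the left side of T via ∧, ∨ and ∃, and each
-- right formula of S implies the right side of T.  Since coverage is closed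
-- under reflexivity, transitivity and paths, the rules ref, tra, nd and cd
-- need no counterpart, and ∀-r becomes ∀*-r once its fresh label is
-- identified with its predecessor.  A step along ≤ in id_q, ⊃-l and ∀-l is
-- performed in T by lift, applied to the literal constituents of the covered
-- formula.  When T contains a principal formula literally, the rule is
-- applied in T itself, and the other copies of that formula, which cannot be
-- contracted, stay covered by its components.  The theorem is the case of
-- the identity renaming and T = S.

open import Defs
open import Data.Bool using (true; false)
open import Data.Empty using (⊥-elim)
open import Data.List using (List; []; _∷_; concatMap)
open import Data.List.Extrema.Nat using (max; xs≤max)
open import Data.List.Membership.Propositional using (_∈_; _∉_)
open import Data.List.Membership.Propositional.Properties
  using (∈-++⁺ˡ; ∈-++⁺ʳ; ∈-∃++; ∈-concatMap⁺)
open import Data.List.Relation.Binary.Permutation.Propositional using (_↭_; ↭-refl; ↭-sym)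
open import Data.List.Relation.Binary.Permutation.Propositional.Properties
  using (All-resp-↭; shift)
open import Data.List.Relation.Binary.Subset.Propositional using (_⊆_)
open import Data.List.Relation.Binary.Subset.Propositional.Properties using (⊆-trans)
open import Data.List.Relation.Unary.All as All using (All; _∷_)
open import Data.List.Relation.Unary.Any as Any using (here; there)
open import Data.Nat using (ℕ; suc; _≟_)
open import Data.Nat.Properties using (n≮n)
open import Data.Product using (_×_; _,_; ∃-syntax)
open import Function using (id; _∘_)
open import Relation.Binary.Construct.Closure.ReflexiveTransitive as Star
  using (Star; ε; _◅_; _◅◅_)
open import Relation.Binary.PropositionalEquality
  using (_≡_; refl; sym; trans; cong; cong₂; subst; subst₂)
open import Relation.Nullary using (does; yes; no)

open Sequent

private variable
  s : System
  R R' : List RAtom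
  Γ Γ' Δ Δ' G G₀ D D₀ : List LFormula
  w v u x y : Label
  a b : Param
  bs : List Param
  z : Var
  p : Pred
  ts : List Term
  A B C : Formula
  f : LFormula
  r : RAtom
  σ σ' : Label → Label
  τ τ' : Param → Param
  S T T' : Sequent

fresh : List ℕ → ℕ
fresh ns = suc (max 0 ns)

fresh-∉ : ∀ ns → fresh ns ∉ ns
fresh-∉ ns n∈ns = n≮n (max 0 ns) (All.lookup (xs≤max 0 ns) n∈ns)

_[_↦_] : (ℕ → ℕ) → ℕ → ℕ → ℕ → ℕ
(g [ k ↦ n ]) m with m ≟ k
... | yes _ = n
... | no  _ = g m

[↦]-at : ∀ g k n → (g [ k ↦ n ]) k ≡ n
[↦]-at g k n with k ≟ k
... | yes _  = refl
... | no k≢k = ⊥-elim (k≢k refl)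

[↦]-away : ∀ {g k n m ks} → k ∉ ks → m ∈ ks → (g [ k ↦ n ]) m ≡ g m
[↦]-away {k = k} {m = m} k∉ks m∈ks with m ≟ k
... | yes refl = ⊥-elim (k∉ks m∈ks)
... | no  _    = refl

Reach : List RAtom → Label → Label → Set
Reach R = Star λ w v → (w ≤ᵣ v) ∈ R

path-trans : Path R w v → Path R v u → Path R w u
path-trans here      q = q
path-trans (fwd e p) q = fwd e (path-trans p q)
path-trans (bwd e p) q = bwd e (path-trans p q)

path-sym : Path R w v → Path R v w
path-sym here      = here
path-sym (fwd e p) = path-trans (path-sym p) (bwd e here)
path-sym (bwd e p) = path-trans (path-sym p) (fwd e here)

path-mono : R ⊆ R' → Path R w v → Path R' w v
path-mono R⊆R' here      = here
path-mono R⊆R' (fwd e p) = fwd (R⊆R' e) (path-mono R⊆R' p)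
path-mono R⊆R' (bwd e p) = bwd (R⊆R' e) (path-mono R⊆R' p)

reach⇒path : Reach R w v → Path R w v
reach⇒path = Star.fold (Path _) fwd here

Domain : List RAtom → Param → Label → Set
Domain R a w = ∃[ u ] ((a ∈D u) ∈ R × Path R u w)

domain-along : Path R w v → Domain R a w → Domain R a v
domain-along q (u , a∈ , p) = u , a∈ , path-trans p q

-- Renaming parameters

renameT : (Param → Param) → Term → Term
renameT τ (var y) = var y
renameT τ (par b) = par (τ b)

renameTs : (Param → Param) → List Term → List Term
renameTs τ []       = []
renameTs τ (t ∷ ts) = renameT τ t ∷ renameTs τ ts

renameF : (Param → Param) → Formula → Formula
renameF τ (atom p ts) = atom p (renameTs τ ts)
renameF τ (¬' A)      = ¬' renameF τ A
renameF τ (A ∨' B)    = renameF τ A ∨' renameF τ B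
renameF τ (A ∧' B)    = renameF τ A ∧' renameF τ B
renameF τ (A ⊃' B)    = renameF τ A ⊃' renameF τ B
renameF τ (∀' y A)    = ∀' y (renameF τ A)
renameF τ (∃' y A)    = ∃' y (renameF τ A)

rename : (Label → Label) → (Param → Param) → LFormula → LFormula
rename σ τ (w , A) = σ w , renameF τ A

renameTs-substTs : ∀ τ ts → renameTs τ (substTs a z ts) ≡ substTs (τ a) z (renameTs τ ts)
renameTs-substTs τ []           = refl
renameTs-substTs {z = z} τ (var y ∷ ts) with does (y ≟ z)
... | true  = cong (_ ∷_) (renameTs-substTs τ ts)
... | false = cong (_ ∷_) (renameTs-substTs τ ts)
renameTs-substTs τ (par b ∷ ts) = cong (_ ∷_) (renameTs-substTs τ ts)

renameF-subst : ∀ τ A → renameF τ (A [ a / z ]) ≡ renameF τ A [ τ a / z ]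
renameF-subst τ (atom p ts) = cong (atom p) (renameTs-substTs τ ts)
renameF-subst τ (¬' A)      = cong ¬'_ (renameF-subst τ A)
renameF-subst τ (A ∨' B)    = cong₂ _∨'_ (renameF-subst τ A) (renameF-subst τ B)
renameF-subst τ (A ∧' B)    = cong₂ _∧'_ (renameF-subst τ A) (renameF-subst τ B)
renameF-subst τ (A ⊃' B)    = cong₂ _⊃'_ (renameF-subst τ A) (renameF-subst τ B)
renameF-subst {z = z} τ (∀' y A) with does (y ≟ z)
... | true  = refl
... | false = cong (∀' y) (renameF-subst τ A)
renameF-subst {z = z} τ (∃' y A) with does (y ≟ z)
... | true  = refl
... | false = cong (∃' y) (renameF-subst τ A)

renameTs-cong : ∀ ts → (∀ {b} → b ∈ paramsTs ts → τ' b ≡ τ b) → renameTs τ' ts ≡ renameTs τ ts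
renameTs-cong []           eq = refl
renameTs-cong (var y ∷ ts) eq = cong (var y ∷_) (renameTs-cong ts eq)
renameTs-cong (par b ∷ ts) eq = cong₂ _∷_ (cong par (eq (here refl))) (renameTs-cong ts (eq ∘ there))

renameF-cong : ∀ A → (∀ {b} → b ∈ paramsF A → τ' b ≡ τ b) → renameF τ' A ≡ renameF τ A
renameF-cong (atom p ts) eq = cong (atom p) (renameTs-cong ts eq)
renameF-cong (¬' A)      eq = cong ¬'_ (renameF-cong A eq)
renameF-cong (A ∨' B)    eq =
  cong₂ _∨'_ (renameF-cong A (eq ∘ ∈-++⁺ˡ)) (renameF-cong B (eq ∘ ∈-++⁺ʳ _))
renameF-cong (A ∧' B)    eq =
  cong₂ _∧'_ (renameF-cong A (eq ∘ ∈-++⁺ˡ)) (renameF-cong B (eq ∘ ∈-++⁺ʳ _))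
renameF-cong (A ⊃' B)    eq =
  cong₂ _⊃'_ (renameF-cong A (eq ∘ ∈-++⁺ˡ)) (renameF-cong B (eq ∘ ∈-++⁺ʳ _))
renameF-cong (∀' y A)    eq = cong (∀' y) (renameF-cong A eq)
renameF-cong (∃' y A)    eq = cong (∃' y) (renameF-cong A eq)

renameF-eigen : ∀ A → a ∉ bs → paramsF A ⊆ bs →
                renameF (τ [ a ↦ b ]) (A [ a / z ]) ≡ renameF τ A [ b / z ]
renameF-eigen {a = a} {τ = τ} {b = b} {z = z} A a∉ A⊆ =
  trans (renameF-subst (τ [ a ↦ b ]) A)
        (cong₂ (λ B c → B [ c / z ]) (renameF-cong A ([↦]-away a∉ ∘ A⊆)) ([↦]-at τ a b))

renameTs-id : ∀ ts → renameTs id ts ≡ ts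
renameTs-id []           = refl
renameTs-id (var y ∷ ts) = cong (var y ∷_) (renameTs-id ts)
renameTs-id (par b ∷ ts) = cong (par b ∷_) (renameTs-id ts)

renameF-id : ∀ A → renameF id A ≡ A
renameF-id (atom p ts) = cong (atom p) (renameTs-id ts)
renameF-id (¬' A)      = cong ¬'_ (renameF-id A)
renameF-id (A ∨' B)    = cong₂ _∨'_ (renameF-id A) (renameF-id B)
renameF-id (A ∧' B)    = cong₂ _∧'_ (renameF-id A) (renameF-id B)
renameF-id (A ⊃' B)    = cong₂ _⊃'_ (renameF-id A) (renameF-id B)
renameF-id (∀' y A)    = cong (∀' y) (renameF-id A)
renameF-id (∃' y A)    = cong (∃' y) (renameF-id A)

rename-id : ∀ f → rename id id f ≡ f
rename-id (w , A) = cong (w ,_) (renameF-id A)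

rename-cong : x ≡ y → (∀ {a} → a ∈ paramsF A → τ' a ≡ τ a) →
              (x , renameF τ' A) ≡ (y , renameF τ A)
rename-cong x≡y τ≗ = cong₂ _,_ x≡y (renameF-cong _ τ≗)

paramsTs-renameTs : {P : Param → Set} → ∀ ts → (∀ {b} → b ∈ paramsTs ts → P (τ b)) →
                    ∀ {a} → a ∈ paramsTs (renameTs τ ts) → P a
paramsTs-renameTs (var y ∷ ts) h a∈         = paramsTs-renameTs ts h a∈
paramsTs-renameTs (par b ∷ ts) h (here refl) = h (here refl)
paramsTs-renameTs (par b ∷ ts) h (there a∈)  = paramsTs-renameTs ts (h ∘ there) a∈

∈-concatMap : ∀ {A B : Set} {g : A → List B} {xs : List A} {y : A} {e : B} →
              y ∈ xs → e ∈ g y → e ∈ concatMap g xs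
∈-concatMap {g = g} y∈xs e∈gy = ∈-concatMap⁺ g (Any.map (λ { refl → e∈gy }) y∈xs)

rel-labels : r ∈ R → labelsR r ⊆ labels (R ∣ Γ ⇒ Δ)
rel-labels r∈R w∈ = ∈-++⁺ˡ (∈-concatMap {g = labelsR} r∈R w∈)

ante-label : (w , A) ∈ Γ → w ∈ labels (R ∣ Γ ⇒ Δ)
ante-label {R = R} f∈Γ =
  ∈-++⁺ʳ (concatMap labelsR R) (∈-++⁺ˡ (∈-concatMap {g = labelsL} f∈Γ (here refl)))

succ-label : (w , A) ∈ Δ → w ∈ labels (R ∣ Γ ⇒ Δ)
succ-label {R = R} {Γ = Γ} f∈Δ =
  ∈-++⁺ʳ (concatMap labelsR R)
         (∈-++⁺ʳ (concatMap labelsL Γ) (∈-concatMap {g = labelsL} f∈Δ (here refl)))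

rel-params : r ∈ R → paramsR r ⊆ params (R ∣ Γ ⇒ Δ)
rel-params r∈R a∈ = ∈-++⁺ˡ (∈-concatMap {g = paramsR} r∈R a∈)

ante-params : (w , A) ∈ Γ → paramsF A ⊆ params (R ∣ Γ ⇒ Δ)
ante-params {R = R} f∈Γ a∈ =
  ∈-++⁺ʳ (concatMap paramsR R) (∈-++⁺ˡ (∈-concatMap {g = paramsL} f∈Γ a∈))

succ-params : (w , A) ∈ Δ → paramsF A ⊆ params (R ∣ Γ ⇒ Δ)
succ-params {R = R} {Γ = Γ} f∈Δ a∈ =
  ∈-++⁺ʳ (concatMap paramsR R) (∈-++⁺ʳ (concatMap paramsL Γ) (∈-concatMap {g = paramsL} f∈Δ a∈))

-- Coverage

-- Covˡ T f: f follows from the left side of T by ∧-, ∨- and ∃-introduction;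
-- Covʳ T f: f entails the right side of T, read through ∧, ∨, ⊃, ¬ and ∀.
data Covˡ (T : Sequent) : LFormula → Set where
  ∈ˡ  : f ∈ ante T → Covˡ T f
  ∧ˡ  : Covˡ T (x , A) → Covˡ T (x , B) → Covˡ T (x , A ∧' B)
  ∨ˡ₁ : Covˡ T (x , A) → Covˡ T (x , A ∨' B)
  ∨ˡ₂ : Covˡ T (x , B) → Covˡ T (x , A ∨' B)
  ∃ˡ  : (a ∈D v) ∈ rel T → Path (rel T) v x → Covˡ T (x , A [ a / z ]) → Covˡ T (x , ∃' z A)

data Covʳ (T : Sequent) : LFormula → Set where
  ∈ʳ  : f ∈ succ T → Covʳ T f
  ∧ʳ₁ : Covʳ T (x , A) → Covʳ T (x , A ∧' B)
  ∧ʳ₂ : Covʳ T (x , B) → Covʳ T (x , A ∧' B)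
  ∨ʳ  : Covʳ T (x , A) → Covʳ T (x , B) → Covʳ T (x , A ∨' B)
  ⊃ʳ  : (x ≤ᵣ v) ∈ rel T → Covˡ T (v , A) → Covʳ T (v , B) → Covʳ T (x , A ⊃' B)
  ¬ʳ  : (x ≤ᵣ v) ∈ rel T → Covˡ T (v , A) → Covʳ T (x , ¬' A)
  ∀ʳ  : (a ∈D x) ∈ rel T → Covʳ T (x , A [ a / z ]) → Covʳ T (x , ∀' z A)

record _⊑_ (T T' : Sequent) : Set where
  field
    rel-⊆  : rel T ⊆ rel T'
    ante-⊑ : All (Covˡ T') (ante T)
    succ-⊑ : All (Covʳ T') (succ T)

open _⊑_

Covˡ-⊑ : T ⊑ T' → Covˡ T f → Covˡ T' f
Covˡ-⊑ T⊑T' (∈ˡ f∈)     = All.lookup (ante-⊑ T⊑T') f∈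
Covˡ-⊑ T⊑T' (∧ˡ c d)    = ∧ˡ (Covˡ-⊑ T⊑T' c) (Covˡ-⊑ T⊑T' d)
Covˡ-⊑ T⊑T' (∨ˡ₁ c)     = ∨ˡ₁ (Covˡ-⊑ T⊑T' c)
Covˡ-⊑ T⊑T' (∨ˡ₂ c)     = ∨ˡ₂ (Covˡ-⊑ T⊑T' c)
Covˡ-⊑ T⊑T' (∃ˡ a∈ p c) = ∃ˡ (rel-⊆ T⊑T' a∈) (path-mono (rel-⊆ T⊑T') p) (Covˡ-⊑ T⊑T' c)

Covʳ-⊑ : T ⊑ T' → Covʳ T f → Covʳ T' f
Covʳ-⊑ T⊑T' (∈ʳ f∈)    = All.lookup (succ-⊑ T⊑T') f∈
Covʳ-⊑ T⊑T' (∧ʳ₁ c)    = ∧ʳ₁ (Covʳ-⊑ T⊑T' c)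
Covʳ-⊑ T⊑T' (∧ʳ₂ c)    = ∧ʳ₂ (Covʳ-⊑ T⊑T' c)
Covʳ-⊑ T⊑T' (∨ʳ c d)   = ∨ʳ (Covʳ-⊑ T⊑T' c) (Covʳ-⊑ T⊑T' d)
Covʳ-⊑ T⊑T' (⊃ʳ e c d) = ⊃ʳ (rel-⊆ T⊑T' e) (Covˡ-⊑ T⊑T' c) (Covʳ-⊑ T⊑T' d)
Covʳ-⊑ T⊑T' (¬ʳ e c)   = ¬ʳ (rel-⊆ T⊑T' e) (Covˡ-⊑ T⊑T' c)
Covʳ-⊑ T⊑T' (∀ʳ a∈ c)  = ∀ʳ (rel-⊆ T⊑T' a∈) (Covʳ-⊑ T⊑T' c)

⊆⇒⊑ : rel T ⊆ rel T' → ante T ⊆ ante T' → succ T ⊆ succ T' → T ⊑ T'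
⊆⇒⊑ R⊆ G⊆ D⊆ = record
  { rel-⊆  = R⊆
  ; ante-⊑ = All.tabulate (∈ˡ ∘ G⊆)
  ; succ-⊑ = All.tabulate (∈ʳ ∘ D⊆)
  }

refocusˡ : G ↭ f ∷ G₀ → Covˡ T f →
           R ⊆ rel T → G₀ ⊆ ante T → D ⊆ succ T → (R ∣ G ⇒ D) ⊑ T
refocusˡ G↭ c R⊆ G₀⊆ D⊆ = record
  { rel-⊆  = R⊆
  ; ante-⊑ = All-resp-↭ (↭-sym G↭) (c ∷ All.tabulate (∈ˡ ∘ G₀⊆))
  ; succ-⊑ = All.tabulate (∈ʳ ∘ D⊆)
  }

refocusʳ : D ↭ f ∷ D₀ → Covʳ T f →
           R ⊆ rel T → G ⊆ ante T → D₀ ⊆ succ T → (R ∣ G ⇒ D) ⊑ T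
refocusʳ D↭ c R⊆ G⊆ D₀⊆ = record
  { rel-⊆  = R⊆
  ; ante-⊑ = All.tabulate (∈ˡ ∘ G⊆)
  ; succ-⊑ = All-resp-↭ (↭-sym D↭) (c ∷ All.tabulate (∈ʳ ∘ D₀⊆))
  }

focusˡ : f ∈ G → (∀ {G₀} → G ↭ f ∷ G₀ → Deriv s (R ∣ f ∷ G₀ ⇒ D)) → Deriv s (R ∣ G ⇒ D)
focusˡ f∈G k with G₁ , G₂ , refl ← ∈-∃++ f∈G =
  perm ↭-refl (↭-sym (shift _ G₁ G₂)) ↭-refl (k (shift _ G₁ G₂))

focusʳ : f ∈ D → (∀ {D₀} → D ↭ f ∷ D₀ → Deriv s (R ∣ G ⇒ f ∷ D₀)) → Deriv s (R ∣ G ⇒ D)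
focusʳ f∈D k with D₁ , D₂ , refl ← ∈-∃++ f∈D =
  perm ↭-refl ↭-refl (↭-sym (shift _ D₁ D₂)) (k (shift _ D₁ D₂))

Justified : (Label → Label) → (Param → Param) → List RAtom → RAtom → Set
Justified σ τ R (w ≤ᵣ v) = Reach R (σ w) (σ v)
Justified σ τ R (a ∈D w) = Domain R (τ a) (σ w)

Justified-mono : ∀ r → R ⊆ R' → Justified σ τ R r → Justified σ τ R' r
Justified-mono (w ≤ᵣ v) R⊆R' ρ            = Star.map R⊆R' ρ
Justified-mono (a ∈D w) R⊆R' (u , a∈ , p) = u , R⊆R' a∈ , path-mono R⊆R' p

Justified-agree : ∀ r → (∀ {w} → w ∈ labelsR r → σ' w ≡ σ w) →
                  (∀ {a} → a ∈ paramsR r → τ' a ≡ τ a) →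
                  Justified σ τ R r → Justified σ' τ' R r
Justified-agree (w ≤ᵣ v) σ≗ τ≗ =
  subst₂ (Reach _) (sym (σ≗ (here refl))) (sym (σ≗ (there (here refl))))
Justified-agree (a ∈D w) σ≗ τ≗ (u , a∈ , p) =
  u , subst (λ b → (b ∈D u) ∈ _) (sym (τ≗ (here refl))) a∈ ,
      subst (Path _ u) (sym (σ≗ (here refl))) p

record Covers (σ : Label → Label) (τ : Param → Param) (S T : Sequent) : Set where
  constructor covers
  field
    justified : All (Justified σ τ (rel T)) (rel S)
    coveredˡ  : All (Covˡ T ∘ rename σ τ) (ante S)
    coveredʳ  : All (Covʳ T ∘ rename σ τ) (succ S)

open Covers

Simulable-at : (Label → Label) → Sequent → Set
Simulable-at σ S = ∀ {τ T} → Covers σ τ S T → IntQCL⁻ T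

Simulable : Sequent → Set
Simulable S = ∀ {σ} → Simulable-at σ S

justification : Covers σ τ S T → r ∈ rel S → Justified σ τ (rel T) r
justification c = All.lookup (justified c)

coverˡ : Covers σ τ S T → f ∈ ante S → Covˡ T (rename σ τ f)
coverˡ c = All.lookup (coveredˡ c)

coverʳ : Covers σ τ S T → f ∈ succ S → Covʳ T (rename σ τ f)
coverʳ c = All.lookup (coveredʳ c)

infixr 5 _∷ᴿ_ _∷ˡ_ _∷ʳ_

_∷ᴿ_ : Justified σ τ (rel T) r → Covers σ τ (R ∣ Γ ⇒ Δ) T → Covers σ τ (r ∷ R ∣ Γ ⇒ Δ) T
j ∷ᴿ covers js cs ds = covers (j ∷ js) cs ds

_∷ˡ_ : Covˡ T (rename σ τ f) → Covers σ τ (R ∣ Γ ⇒ Δ) T → Covers σ τ (R ∣ f ∷ Γ ⇒ Δ) T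
c ∷ˡ covers js cs ds = covers js (c ∷ cs) ds

_∷ʳ_ : Covʳ T (rename σ τ f) → Covers σ τ (R ∣ Γ ⇒ Δ) T → Covers σ τ (R ∣ Γ ⇒ f ∷ Δ) T
d ∷ʳ covers js cs ds = covers js cs (d ∷ ds)

Covers-⊑ : T ⊑ T' → Covers σ τ S T → Covers σ τ S T'
Covers-⊑ T⊑T' (covers js cs ds) =
  covers (All.map (Justified-mono _ (rel-⊆ T⊑T')) js)
         (All.map (Covˡ-⊑ T⊑T') cs) (All.map (Covʳ-⊑ T⊑T') ds)

Covers-↭ : R ↭ R' → Γ ↭ Γ' → Δ ↭ Δ' →
           Covers σ τ (R' ∣ Γ' ⇒ Δ') T → Covers σ τ (R ∣ Γ ⇒ Δ) T
Covers-↭ R↭ Γ↭ Δ↭ (covers js cs ds) =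
  covers (All-resp-↭ (↭-sym R↭) js) (All-resp-↭ (↭-sym Γ↭) cs) (All-resp-↭ (↭-sym Δ↭) ds)

Covers-refl : ∀ S → Covers id id S S
Covers-refl S@(R ∣ Γ ⇒ Δ) = covers
  (All.tabulate justified-refl)
  (All.tabulate λ f∈ → subst (Covˡ S) (sym (rename-id _)) (∈ˡ f∈))
  (All.tabulate λ f∈ → subst (Covʳ S) (sym (rename-id _)) (∈ʳ f∈))
  where
  justified-refl : r ∈ R → Justified id id R r
  justified-refl {w ≤ᵣ v} e  = e ◅ ε
  justified-refl {a ∈D w} a∈ = w , a∈ , here

Covers-agree : (∀ {w} → w ∈ labels S → σ' w ≡ σ w) → (∀ {a} → a ∈ params S → τ' a ≡ τ a) →
               Covers σ τ S T → Covers σ' τ' S T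
Covers-agree {S = R ∣ Γ ⇒ Δ} {T = T} σ≗ τ≗ (covers js cs ds) = covers
  (All.tabulate λ r∈ →
     Justified-agree _ (σ≗ ∘ rel-labels {Γ = Γ} {Δ = Δ} r∈) (τ≗ ∘ rel-params {Γ = Γ} {Δ = Δ} r∈)
                     (All.lookup js r∈))
  (All.tabulate λ {(w , A)} f∈ →
     subst (Covˡ T) (sym (rename-cong (σ≗ (ante-label {R = R} {Δ = Δ} f∈))
                                      (τ≗ ∘ ante-params {R = R} {Δ = Δ} f∈)))
           (All.lookup cs f∈))
  (All.tabulate λ {(w , A)} f∈ →
     subst (Covʳ T) (sym (rename-cong (σ≗ (succ-label {R = R} {Γ = Γ} f∈))
                                      (τ≗ ∘ succ-params {R = R} {Γ = Γ} f∈)))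
           (All.lookup ds f∈))

Covers-fresh-label : v ∉ labels S → Covers σ τ S T → Covers (σ [ v ↦ u ]) τ S T
Covers-fresh-label v∉ = Covers-agree ([↦]-away v∉) (λ _ → refl)

Covers-fresh-param : a ∉ params S → Covers σ τ S T → Covers σ (τ [ a ↦ b ]) S T
Covers-fresh-param a∉ = Covers-agree (λ _ → refl) ([↦]-away a∉)

path-image : Covers σ τ (R ∣ Γ ⇒ Δ) T → Path R v w → Path (rel T) (σ v) (σ w)
path-image c here      = here
path-image c (fwd e p) = path-trans (reach⇒path (justification c e)) (path-image c p)
path-image c (bwd e p) = path-trans (path-sym (reach⇒path (justification c e))) (path-image c p)

domain-image : Covers σ τ (R ∣ Γ ⇒ Δ) T → Domain R a w → Domain (rel T) (τ a) (σ w)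
domain-image c (v , a∈ , p) = domain-along (path-image c p) (justification c a∈)

relabel : (P : LFormula → Set) → x ≡ y → P (y , A) → P (x , A)
relabel P x≡y = subst (λ l → P (l , _)) (sym x≡y)

instantiate : (P : LFormula → Set) → ∀ A →
              P (x , renameF τ A [ τ a / z ]) → P (x , renameF τ (A [ a / z ]))
instantiate P A = subst (λ B → P (_ , B)) (sym (renameF-subst _ A))

eigen : (P : LFormula → Set) → ∀ A → a ∉ bs → paramsF A ⊆ bs →
        P (x , renameF τ A [ b / z ]) → P (x , renameF (τ [ a ↦ b ]) (A [ a / z ]))
eigen P A a∉ A⊆ = subst (λ B → P (_ , B)) (sym (renameF-eigen A a∉ A⊆))

eigen-domain : ∀ τ a → Domain R b x → Domain R ((τ [ a ↦ b ]) a) x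
eigen-domain {b = b} τ a = subst (λ c → Domain _ c _) (sym ([↦]-at τ a b))

fresh-successor : v ∉ labels (R ∣ Γ ⇒ (w , A) ∷ Δ) → (σ w ≤ᵣ u) ∈ rel T →
                  Covers σ τ (R ∣ Γ ⇒ (w , A) ∷ Δ) T →
                  Covers (σ [ v ↦ u ]) τ ((w ≤ᵣ v) ∷ R ∣ Γ ⇒ Δ) T
fresh-successor {v = v} {R = R} {Γ = Γ} {w = w} {A = A} {Δ = Δ} {σ = σ} {u = u} v∉ e c
  with covers js cs (_ ∷ ds) ← Covers-fresh-label {u = u} v∉ c =
  covers (subst₂ (Reach _) (sym σ'w≡σw) (sym ([↦]-at σ v u)) (e ◅ ε) ∷ js) cs ds
  where
  σ'w≡σw : (σ [ v ↦ u ]) w ≡ σ w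
  σ'w≡σw = [↦]-away v∉ (succ-label {Δ = (w , A) ∷ Δ} {R = R} {Γ = Γ} (here refl))

-- Lifting covered formulas in IntQCL⁻

-- The cover may live over a smaller antecedent G₀, so that the recursion on
-- the ∧ˡ case stays structural.
lift-covered : G₀ ⊆ G → (x ≤ᵣ y) ∈ R → Covˡ (R ∣ G₀ ⇒ D) (x , C) →
               (∀ {G'} → G ⊆ G' → Covˡ (R ∣ G' ⇒ D) (y , C) → IntQCL⁻ (R ∣ G' ⇒ D)) →
               IntQCL⁻ (R ∣ G ⇒ D)
lift-covered G₀⊆ e (∈ˡ f∈) k = lift e (G₀⊆ f∈) (k there (∈ˡ (here refl)))
lift-covered G₀⊆ e (∧ˡ c d) k =
  lift-covered G₀⊆ e c λ G⊆₁ c' →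
  lift-covered (⊆-trans G₀⊆ G⊆₁) e d λ G⊆₂ d' →
  k (⊆-trans G⊆₁ G⊆₂) (∧ˡ (Covˡ-⊑ (⊆⇒⊑ id G⊆₂ id) c') d')
lift-covered G₀⊆ e (∨ˡ₁ c) k = lift-covered G₀⊆ e c λ G⊆ c' → k G⊆ (∨ˡ₁ c')
lift-covered G₀⊆ e (∨ˡ₂ c) k = lift-covered G₀⊆ e c λ G⊆ c' → k G⊆ (∨ˡ₂ c')
lift-covered G₀⊆ e (∃ˡ a∈ p c) k =
  lift-covered G₀⊆ e c λ G⊆ c' → k G⊆ (∃ˡ a∈ (path-trans p (fwd e here)) c')

lift*-covered : Reach R x y → Covˡ (R ∣ G ⇒ D) (x , C) →
                (∀ {G'} → G ⊆ G' → Covˡ (R ∣ G' ⇒ D) (y , C) → IntQCL⁻ (R ∣ G' ⇒ D)) →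
                IntQCL⁻ (R ∣ G ⇒ D)
lift*-covered ε       c k = k id c
lift*-covered (e ◅ ρ) c k =
  lift-covered id e c λ G⊆₁ c' → lift*-covered ρ c' λ G⊆₂ → k (⊆-trans G⊆₁ G⊆₂)

id-q⁻ : (∀ {a} → a ∈ paramsTs ts → Domain R a x) → Reach R x y →
        (x , atom p ts) ∈ G → (y , atom p ts) ∈ D → IntQCL⁻ (R ∣ G ⇒ D)
id-q⁻ dom ρ x∈ y∈ = lift*-covered ρ (∈ˡ x∈) λ where
  _ (∈ˡ y∈') → id*-q (domain-along (reach⇒path ρ) ∘ dom) y∈' y∈

⊥-l⁻ : (x , p₀) ∈ G → (x , ¬' p₀) ∈ G → IntQCL⁻ (R ∣ G ⇒ D)
⊥-l⁻ p∈ ¬p∈ = ¬-l ¬p∈ (id*-q (λ ()) p∈ (here refl))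

-- Simulating the rules of IntQCL

id-sim : (w , atom p ts) ∈ Γ → (v , atom p ts) ∈ Δ →
         (∀ {a} → a ∈ paramsTs ts → Justified σ τ (rel T) (a ∈D w)) →
         Reach (rel T) (σ w) (σ v) → Covers σ τ (R ∣ Γ ⇒ Δ) T → IntQCL⁻ T
id-sim {ts = ts} w∈ v∈ dom ρ c with coverˡ c w∈ | coverʳ c v∈
... | ∈ˡ w∈' | ∈ʳ v∈' = id-q⁻ (paramsTs-renameTs ts dom) ρ w∈' v∈'

⊥-l-sim : (w , ⊥') ∈ Γ → Simulable (R ∣ Γ ⇒ Δ)
⊥-l-sim w∈ c with coverˡ c w∈
... | ∧ˡ (∈ˡ p∈) (∈ˡ ¬p∈) = ⊥-l⁻ p∈ ¬p∈
... | ∈ˡ ⊥∈               = focusˡ ⊥∈ λ _ → ∧-l (⊥-l⁻ (here refl) (there (here refl)))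

∧-l-sim : Simulable (R ∣ (w , A) ∷ (w , B) ∷ Γ ⇒ Δ) → Simulable (R ∣ (w , A ∧' B) ∷ Γ ⇒ Δ)
∧-l-sim ih (covers js (∧ˡ c d ∷ cs) ds) = ih (covers js (c ∷ d ∷ cs) ds)
∧-l-sim ih (covers js (∈ˡ f∈ ∷ cs) ds) = focusˡ f∈ λ G↭ →
  ∧-l (ih (∈ˡ (here refl) ∷ˡ ∈ˡ (there (here refl)) ∷ˡ
    Covers-⊑ (refocusˡ G↭ (∧ˡ (∈ˡ (here refl)) (∈ˡ (there (here refl)))) id (there ∘ there) id)
             (covers js cs ds)))

∨-l-sim : Simulable (R ∣ (w , A) ∷ Γ ⇒ Δ) → Simulable (R ∣ (w , B) ∷ Γ ⇒ Δ) →
          Simulable (R ∣ (w , A ∨' B) ∷ Γ ⇒ Δ)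
∨-l-sim ih₁ ih₂ (covers js (∨ˡ₁ c ∷ cs) ds) = ih₁ (covers js (c ∷ cs) ds)
∨-l-sim ih₁ ih₂ (covers js (∨ˡ₂ c ∷ cs) ds) = ih₂ (covers js (c ∷ cs) ds)
∨-l-sim ih₁ ih₂ (covers js (∈ˡ f∈ ∷ cs) ds) = focusˡ f∈ λ G↭ →
  ∨-l (ih₁ (∈ˡ (here refl) ∷ˡ
            Covers-⊑ (refocusˡ G↭ (∨ˡ₁ (∈ˡ (here refl))) id there id) (covers js cs ds)))
      (ih₂ (∈ˡ (here refl) ∷ˡ
            Covers-⊑ (refocusˡ G↭ (∨ˡ₂ (∈ˡ (here refl))) id there id) (covers js cs ds)))

∧-r-sim : Simulable (R ∣ Γ ⇒ (w , A) ∷ Δ) → Simulable (R ∣ Γ ⇒ (w , B) ∷ Δ) →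
          Simulable (R ∣ Γ ⇒ (w , A ∧' B) ∷ Δ)
∧-r-sim ih₁ ih₂ (covers js cs (∧ʳ₁ d ∷ ds)) = ih₁ (covers js cs (d ∷ ds))
∧-r-sim ih₁ ih₂ (covers js cs (∧ʳ₂ d ∷ ds)) = ih₂ (covers js cs (d ∷ ds))
∧-r-sim ih₁ ih₂ (covers js cs (∈ʳ f∈ ∷ ds)) = focusʳ f∈ λ D↭ →
  ∧-r (ih₁ (∈ʳ (here refl) ∷ʳ
            Covers-⊑ (refocusʳ D↭ (∧ʳ₁ (∈ʳ (here refl))) id id there) (covers js cs ds)))
      (ih₂ (∈ʳ (here refl) ∷ʳ
            Covers-⊑ (refocusʳ D↭ (∧ʳ₂ (∈ʳ (here refl))) id id there) (covers js cs ds)))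

∨-r-sim : Simulable (R ∣ Γ ⇒ (w , A) ∷ (w , B) ∷ Δ) → Simulable (R ∣ Γ ⇒ (w , A ∨' B) ∷ Δ)
∨-r-sim ih (covers js cs (∨ʳ d e ∷ ds)) = ih (covers js cs (d ∷ e ∷ ds))
∨-r-sim ih (covers js cs (∈ʳ f∈ ∷ ds)) = focusʳ f∈ λ D↭ →
  ∨-r (ih (∈ʳ (here refl) ∷ʳ ∈ʳ (there (here refl)) ∷ʳ
    Covers-⊑ (refocusʳ D↭ (∨ʳ (∈ʳ (here refl)) (∈ʳ (there (here refl)))) id id (there ∘ there))
             (covers js cs ds)))

¬-l-sim : (w , ¬' A) ∈ Γ → Simulable (R ∣ Γ ⇒ (w , A) ∷ Δ) → Simulable (R ∣ Γ ⇒ Δ)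
¬-l-sim w∈ ih c with coverˡ c w∈
... | ∈ˡ ¬∈ = ¬-l ¬∈ (ih (∈ʳ (here refl) ∷ʳ Covers-⊑ (⊆⇒⊑ id id there) c))

⊃-l-sim : (w , A ⊃' B) ∈ Γ →
          Simulable (R ∣ Γ ⇒ (v , A) ∷ Δ) → Simulable (R ∣ (v , B) ∷ Γ ⇒ Δ) →
          Reach (rel T) (σ w) (σ v) → Covers σ τ (R ∣ Γ ⇒ Δ) T → IntQCL⁻ T
⊃-l-sim w∈ ih₁ ih₂ ρ c with coverˡ c w∈
... | ∈ˡ ⊃∈ = lift*-covered ρ (∈ˡ ⊃∈) λ where
  G⊆ (∈ˡ ⊃∈') → ⊃*-l ⊃∈' (ih₁ (∈ʳ (here refl) ∷ʳ Covers-⊑ (⊆⇒⊑ id G⊆ there) c))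
                          (ih₂ (∈ˡ (here refl) ∷ˡ Covers-⊑ (⊆⇒⊑ id (there ∘ G⊆) id) c))

∀-l-sim : (w , ∀' z A) ∈ Γ → Simulable (R ∣ (v , A [ a / z ]) ∷ Γ ⇒ Δ) →
          Reach (rel T) (σ w) (σ v) → Justified σ τ (rel T) (a ∈D v) →
          Covers σ τ (R ∣ Γ ⇒ Δ) T → IntQCL⁻ T
∀-l-sim {A = A} w∈ ih ρ (u , a∈ , p) c with coverˡ c w∈
... | ∈ˡ ∀∈ = lift*-covered ρ (∈ˡ ∀∈) λ where
  G⊆ (∈ˡ ∀∈') → ∀*-l a∈ p ∀∈' (ih (instantiate (Covˡ _) A (∈ˡ (here refl)) ∷ˡ
                                    Covers-⊑ (⊆⇒⊑ id (there ∘ G⊆) id) c))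

∃-r-sim : (w , ∃' z A) ∈ Δ → Simulable (R ∣ Γ ⇒ (w , A [ a / z ]) ∷ Δ) →
          Justified σ τ (rel T) (a ∈D w) → Covers σ τ (R ∣ Γ ⇒ Δ) T → IntQCL⁻ T
∃-r-sim {A = A} w∈ ih (u , a∈ , p) c with coverʳ c w∈
... | ∈ʳ ∃∈ =
  ∃*-r a∈ p ∃∈ (ih (instantiate (Covʳ _) A (∈ʳ (here refl)) ∷ʳ Covers-⊑ (⊆⇒⊑ id id there) c))

lift-sim : (w , A) ∈ Γ → Simulable (R ∣ (u , A) ∷ Γ ⇒ Δ) →
           Reach (rel T) (σ w) (σ u) → Covers σ τ (R ∣ Γ ⇒ Δ) T → IntQCL⁻ T
lift-sim w∈ ih ρ c =
  lift*-covered ρ (coverˡ c w∈) λ G⊆ c' → ih (c' ∷ˡ Covers-⊑ (⊆⇒⊑ id G⊆ id) c)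

⊃ʳ-premise : v ∉ labels (R ∣ Γ ⇒ (w , A ⊃' B) ∷ Δ) →
             (σ w ≤ᵣ u) ∈ rel T → Covˡ T (u , renameF τ A) → Covʳ T (u , renameF τ B) →
             Covers σ τ (R ∣ Γ ⇒ (w , A ⊃' B) ∷ Δ) T →
             Covers (σ [ v ↦ u ]) τ ((w ≤ᵣ v) ∷ R ∣ (v , A) ∷ Γ ⇒ (v , B) ∷ Δ) T
⊃ʳ-premise {v = v} {σ = σ} {u = u} v∉ e cA cB c =
  relabel (Covˡ _) ([↦]-at σ v u) cA ∷ˡ relabel (Covʳ _) ([↦]-at σ v u) cB ∷ʳ fresh-successor v∉ e c

⊃-r-sim : v ∉ labels (R ∣ Γ ⇒ (w , A ⊃' B) ∷ Δ) →
          Simulable ((w ≤ᵣ v) ∷ R ∣ (v , A) ∷ Γ ⇒ (v , B) ∷ Δ) →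
          Simulable (R ∣ Γ ⇒ (w , A ⊃' B) ∷ Δ)
⊃-r-sim v∉ ih c@(covers _ _ (⊃ʳ e cA cB ∷ _)) = ih (⊃ʳ-premise v∉ e cA cB c)
⊃-r-sim v∉ ih c@(covers _ _ (∈ʳ f∈ ∷ _))      = focusʳ f∈ λ D↭ →
  ⊃-r (fresh-∉ _) (ih (⊃ʳ-premise v∉ (here refl) (∈ˡ (here refl)) (∈ʳ (here refl))
    (Covers-⊑ (refocusʳ D↭ (⊃ʳ (here refl) (∈ˡ (here refl)) (∈ʳ (here refl))) there there there) c)))

¬ʳ-premise : v ∉ labels (R ∣ Γ ⇒ (w , ¬' A) ∷ Δ) →
             (σ w ≤ᵣ u) ∈ rel T → Covˡ T (u , renameF τ A) →
             Covers σ τ (R ∣ Γ ⇒ (w , ¬' A) ∷ Δ) T →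
             Covers (σ [ v ↦ u ]) τ ((w ≤ᵣ v) ∷ R ∣ (v , A) ∷ Γ ⇒ Δ) T
¬ʳ-premise {v = v} {σ = σ} {u = u} v∉ e cA c =
  relabel (Covˡ _) ([↦]-at σ v u) cA ∷ˡ fresh-successor v∉ e c

¬-r-sim : v ∉ labels (R ∣ Γ ⇒ (w , ¬' A) ∷ Δ) →
          Simulable ((w ≤ᵣ v) ∷ R ∣ (v , A) ∷ Γ ⇒ Δ) →
          Simulable (R ∣ Γ ⇒ (w , ¬' A) ∷ Δ)
¬-r-sim v∉ ih c@(covers _ _ (¬ʳ e cA ∷ _)) = ih (¬ʳ-premise v∉ e cA c)
¬-r-sim v∉ ih c@(covers _ _ (∈ʳ f∈ ∷ _))   = focusʳ f∈ λ D↭ →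
  ¬-r (fresh-∉ _) (ih (¬ʳ-premise v∉ (here refl) (∈ˡ (here refl))
    (Covers-⊑ (refocusʳ D↭ (¬ʳ (here refl) (∈ˡ (here refl))) there there id) c)))

∃ˡ-premise : a ∉ params (R ∣ (w , ∃' z A) ∷ Γ ⇒ Δ) →
             Domain (rel T) b (σ w) → Covˡ T (σ w , renameF τ A [ b / z ]) →
             Covers σ τ (R ∣ (w , ∃' z A) ∷ Γ ⇒ Δ) T →
             Covers σ (τ [ a ↦ b ]) ((a ∈D w) ∷ R ∣ (w , A [ a / z ]) ∷ Γ ⇒ Δ) T
∃ˡ-premise {a = a} {R = R} {w = w} {z = z} {A = A} {Γ = Γ} {Δ = Δ} {b = b} {τ = τ} a∉ dom cA c
  with covers js (_ ∷ cs) ds ← Covers-fresh-param {b = b} a∉ c =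
  covers (eigen-domain τ a dom ∷ js)
         (eigen (Covˡ _) A a∉ (ante-params {Γ = (w , ∃' z A) ∷ Γ} {R = R} {Δ = Δ} (here refl)) cA ∷ cs) ds

∃-l-sim : a ∉ params (R ∣ (w , ∃' z A) ∷ Γ ⇒ Δ) →
          Simulable ((a ∈D w) ∷ R ∣ (w , A [ a / z ]) ∷ Γ ⇒ Δ) →
          Simulable (R ∣ (w , ∃' z A) ∷ Γ ⇒ Δ)
∃-l-sim a∉ ih c@(covers _ (∃ˡ b∈ p cA ∷ _) _) = ih (∃ˡ-premise a∉ (_ , b∈ , p) cA c)
∃-l-sim a∉ ih c@(covers _ (∈ˡ f∈ ∷ _) _)      = focusˡ f∈ λ G↭ →
  ∃-l (fresh-∉ _) (ih (∃ˡ-premise a∉ (_ , here refl , here) (∈ˡ (here refl))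
    (Covers-⊑ (refocusˡ G↭ (∃ˡ (here refl) here (∈ˡ (here refl))) there there id) c)))

∀ʳ-premise : a ∉ params (R ∣ Γ ⇒ (w , ∀' z A) ∷ Δ) →
             (b ∈D σ w) ∈ rel T → Covʳ T (σ w , renameF τ A [ b / z ]) →
             Covers σ τ (R ∣ Γ ⇒ (w , ∀' z A) ∷ Δ) T →
             Covers σ (τ [ a ↦ b ]) ((a ∈D w) ∷ R ∣ Γ ⇒ (w , A [ a / z ]) ∷ Δ) T
∀ʳ-premise {a = a} {R = R} {Γ = Γ} {w = w} {z = z} {A = A} {Δ = Δ} {b = b} {τ = τ} a∉ b∈ cA c
  with covers js cs (_ ∷ ds) ← Covers-fresh-param {b = b} a∉ c =
  covers (eigen-domain τ a (_ , b∈ , here) ∷ js) cs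
         (eigen (Covʳ _) A a∉ (succ-params {Δ = (w , ∀' z A) ∷ Δ} {R = R} {Γ = Γ} (here refl)) cA ∷ ds)

-- Stated at a fixed label renaming, so that ∀-r-sim can feed it the premise of ∀-r.
∀*-r-sim : a ∉ params (R ∣ Γ ⇒ (w , ∀' z A) ∷ Δ) →
           Simulable-at σ ((a ∈D w) ∷ R ∣ Γ ⇒ (w , A [ a / z ]) ∷ Δ) →
           Simulable-at σ (R ∣ Γ ⇒ (w , ∀' z A) ∷ Δ)
∀*-r-sim a∉ ih c@(covers _ _ (∀ʳ b∈ cA ∷ _)) = ih (∀ʳ-premise a∉ b∈ cA c)
∀*-r-sim a∉ ih c@(covers _ _ (∈ʳ f∈ ∷ _))    = focusʳ f∈ λ D↭ →
  ∀*-r (fresh-∉ _) (ih (∀ʳ-premise a∉ (here refl) (∈ʳ (here refl))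
    (Covers-⊑ (refocusʳ D↭ (∀ʳ (here refl) (∈ʳ (here refl))) there id there) c)))

collapse : σ v ≡ σ w → Covers σ τ ((a ∈D w) ∷ R ∣ Γ ⇒ (w , A) ∷ Δ) T →
           Covers σ τ ((w ≤ᵣ v) ∷ (a ∈D v) ∷ R ∣ Γ ⇒ (v , A) ∷ Δ) T
collapse σv≡σw (covers (dom ∷ js) cs (d ∷ ds)) = covers
  (subst (Reach _ _) (sym σv≡σw) ε ∷ subst (Domain _ _) (sym σv≡σw) dom ∷ js) cs
  (relabel (Covʳ _) σv≡σw d ∷ ds)

-- ∀-r is ∀*-r after sending its fresh label v to the image of w.
∀-r-sim : v ∉ labels (R ∣ Γ ⇒ (w , ∀' z A) ∷ Δ) →
          a ∉ params (R ∣ Γ ⇒ (w , ∀' z A) ∷ Δ) →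
          Simulable ((w ≤ᵣ v) ∷ (a ∈D v) ∷ R ∣ Γ ⇒ (v , A [ a / z ]) ∷ Δ) →
          Simulable (R ∣ Γ ⇒ (w , ∀' z A) ∷ Δ)
∀-r-sim {v = v} {R = R} {Γ = Γ} {w = w} {z = z} {A = A} {Δ = Δ} v∉ a∉ ih {σ} c =
  ∀*-r-sim a∉ (λ c' → ih (collapse σ'v≡σ'w c')) (Covers-fresh-label {u = σ w} v∉ c)
  where
  σ'v≡σ'w : (σ [ v ↦ σ w ]) v ≡ (σ [ v ↦ σ w ]) w
  σ'v≡σ'w = trans ([↦]-at σ v (σ w))
                  (sym ([↦]-away v∉ (succ-label {Δ = (w , ∀' z A) ∷ Δ} {R = R} {Γ = Γ} (here refl))))

simulate : IntQCL S → Simulable S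
simulate (perm R↭ Γ↭ Δ↭ D)  c = simulate D (Covers-↭ R↭ Γ↭ Δ↭ c)
simulate (id-q e dom w∈ v∈) c = id-sim w∈ v∈ (justification c ∘ dom) (justification c e) c
simulate (⊥-l w∈)             = ⊥-l-sim w∈
simulate (∧-l D)              = ∧-l-sim (simulate D)
simulate (∧-r D₁ D₂)          = ∧-r-sim (simulate D₁) (simulate D₂)
simulate (∨-l D₁ D₂)          = ∨-l-sim (simulate D₁) (simulate D₂)
simulate (∨-r D)              = ∨-r-sim (simulate D)
simulate (⊃-r v∉ D)           = ⊃-r-sim v∉ (simulate D)
simulate (⊃-l e w∈ D₁ D₂)   c = ⊃-l-sim w∈ (simulate D₁) (simulate D₂) (justification c e) c
simulate (ref D)            c = simulate D (ε ∷ᴿ c)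
simulate (tra e₁ e₂ D)      c = simulate D ((justification c e₁ ◅◅ justification c e₂) ∷ᴿ c)
simulate (∀-r v∉ a∉ D)        = ∀-r-sim v∉ a∉ (simulate D)
simulate (∃-r a∈ w∈ D)      c = ∃-r-sim w∈ (simulate D) (justification c a∈) c
simulate (∃-l a∉ D)           = ∃-l-sim a∉ (simulate D)
simulate (∀-l e a∈ w∈ D)    c = ∀-l-sim w∈ (simulate D) (justification c e) (justification c a∈) c
simulate (nd e a∈ D)        c =
  simulate D (domain-along (reach⇒path (justification c e)) (justification c a∈) ∷ᴿ c)
simulate (cd e a∈ D)        c =
  simulate D (domain-along (path-sym (reach⇒path (justification c e))) (justification c a∈) ∷ᴿ c)
simulate (id*-q dom w∈ w∈') c = id-sim w∈ w∈' (domain-image c ∘ dom) ε c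
simulate (¬-r v∉ D)           = ¬-r-sim v∉ (simulate D)
simulate (¬-l w∈ D)           = ¬-l-sim w∈ (simulate D)
simulate (⊃*-l w∈ D₁ D₂)    c = ⊃-l-sim w∈ (simulate D₁) (simulate D₂) ε c
simulate (∀*-r a∉ D)          = ∀*-r-sim a∉ (simulate D)
simulate (∀*-l a∈ p w∈ D)   c = ∀-l-sim w∈ (simulate D) ε (domain-image c (_ , a∈ , p)) c
simulate (∃*-r a∈ p w∈ D)   c = ∃-r-sim w∈ (simulate D) (domain-image c (_ , a∈ , p)) c
simulate (lift e w∈ D)      c = lift-sim w∈ (simulate D) (justification c e) c

theorem5 : (S : Sequent) → IntQCL S → IntQCL⁻ S
theorem5 S D = simulate D (Covers-refl S)
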